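{- Let $G$ be a simple stochastic game and let $S$ be a nonempty set of nodes of $G$ such that: (1) every max node in $S$ has at least one out-arc whose head lies in $S$; (2) every min node in $S$ has at least one out-arc whose head lies in $S$; (3) every average node in $S$ has both of its out-arcs with heads in $S$; (4) $S$ contains no terminal node. Then $S$ contains a bad subgraph, i.e. there is a set $S'\subseteq S$ that is a bad subgraph of $G$.
   Context: A simple stochastic game (SSG) is a finite directed graph $G$ whose nodes are of four types: max, min, average and terminal. There are exactly two terminal nodes, terminal-0 and terminal-1, which have no out-arcs; every max, min and average node has exactly two out-arcs (the two arcs may coincide and may be self-loops). A bad subgraph of $G$ is a nonempty set $S$ of nodes of $G$ such that: (1) every max node in $S$ has at least one out-arc with head in $S$; (2) every min node in $S$ has at least one out-arc with head in $S$; (3) every average node in $S$ has both out-arcs with heads in $S$; (4) $S$ contains no terminal node; (5) $S$ is strongly connected, i.e. for any $u,v\in S$ there is a directed path from $u$ to $v$ in $G$ using only nodes of $S$. -}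

module Defs where

open import Data.Nat using (ℕ)
open import Data.Fin using (Fin)
open import Data.Fin.Subset using (Subset; _∈_; _∉_; _⊆_; Nonempty)
open import Data.Product using (_×_; ∃-syntax)
open import Data.Sum using (_⊎_)
open import Relation.Binary.PropositionalEquality using (_≡_; _≢_)
open import Relation.Binary.Construct.Closure.ReflexiveTransitive using (Star)

data NodeType : Set where
  maxN minN avgN term0 term1 : NodeType

-- Every node v is given two out-neighbours out₁ v and out₂ v; these are the
-- two out-arcs of v when v is a max/min/average node (they may coincide and
-- may be self-loops).  For the terminal nodes they carry no meaning: terminal
-- nodes have no out-arcs (see the Arc relation below, which ignores them).
record SSG (n : ℕ) : Set where
  field
    type  : Fin n → NodeType
    out₁  : Fin n → Fin n
    out₂  : Fin n → Fin n
    t0    : Fin n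
    t1    : Fin n
    t0-type : type t0 ≡ term0
    t1-type : type t1 ≡ term1
    t0-unique : ∀ v → type v ≡ term0 → v ≡ t0
    t1-unique : ∀ v → type v ≡ term1 → v ≡ t1

module _ {n : ℕ} (G : SSG n) where
  open SSG G

  IsTerminal : Fin n → Set
  IsTerminal v = (type v ≡ term0) ⊎ (type v ≡ term1)

  Arc : Fin n → Fin n → Set
  Arc u v = ((type u ≡ maxN) ⊎ (type u ≡ minN) ⊎ (type u ≡ avgN))
            × ((out₁ u ≡ v) ⊎ (out₂ u ≡ v))

  ArcIn : Subset n → Fin n → Fin n → Set
  ArcIn S u v = (u ∈ S) × (v ∈ S) × Arc u v

  PathIn : Subset n → Fin n → Fin n → Set
  PathIn S = Star (ArcIn S)

  Closed : Subset n → Set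
  Closed S = ∀ v → v ∈ S →
      (type v ≡ maxN → (out₁ v ∈ S) ⊎ (out₂ v ∈ S))
    × (type v ≡ minN → (out₁ v ∈ S) ⊎ (out₂ v ∈ S))
    × (type v ≡ avgN → (out₁ v ∈ S) × (out₂ v ∈ S))
    × (type v ≢ term0) × (type v ≢ term1)

  StronglyConnected : Subset n → Set
  StronglyConnected S = ∀ u v → u ∈ S → v ∈ S → PathIn S u v

  BadSubgraph : Subset n → Set
  BadSubgraph S = Nonempty S × Closed S × StronglyConnected S

{-# OPTIONS --safe #-}
-- Induct on S along strict inclusion.  If every node of S reaches every node of S
-- by a path inside S, then S itself is bad.  Otherwise some u ∈ S does not reach
-- some z ∈ S.  The set R of nodes reachable from u inside S is closed under the
-- arcs of S, so it inherits conditions (1)-(4) from S; it contains u but not z,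
-- so the induction hypothesis applies to R.
module Submission where

open import Defs
open import Data.Nat using (ℕ)
open import Data.Fin using (Fin; _≟_)
open import Data.Fin.Properties using (any?)
open import Data.Fin.Subset using (Subset; _∈_; _⊆_; _⊂_; _⊃_; _∪_; ⁅_⁆; Nonempty)
open import Data.Fin.Subset.Properties
  using (_∈?_; x∈⁅x⁆; x∈⁅y⁆⇒x≡y; p⊆p∪q; q⊆p∪q; x∈p∪q⁻; ⊆-refl; ⊆-trans)
open import Data.Fin.Subset.Induction using (⊂-wellFounded; ⊃-wellFounded)
open import Data.Product using (_×_; ∃-syntax; _,_)
open import Data.Sum using (_⊎_; inj₁; inj₂)
import Data.Product as Product
import Data.Sum as Sum
open import Induction.WellFounded using (Acc; acc)
open import Level using (Level)
open import Relation.Binary.Core using (Rel)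
open import Relation.Binary.Definitions using (Decidable)
open import Relation.Binary.PropositionalEquality using (_≡_; refl; sym; subst)
open import Relation.Binary.Construct.Closure.ReflexiveTransitive using (Star; ε; _◅_; _◅◅_)
open import Relation.Nullary using (Dec; yes; no; ¬?)
open import Relation.Nullary.Decidable using (_×-dec_; _⊎-dec_; decidable-stable)

record ReachableSet {n : ℕ} {ℓ : Level} (_⟶_ : Rel (Fin n) ℓ) (u : Fin n) : Set ℓ where
  field
    nodes   : Subset n
    source∈ : u ∈ nodes
    path    : ∀ {x} → x ∈ nodes → Star _⟶_ u x
    closed  : ∀ {x y} → x ∈ nodes → x ⟶ y → y ∈ nodes

reachableSet : ∀ {n ℓ} {_⟶_ : Rel (Fin n) ℓ} → Decidable _⟶_ → ∀ u → ReachableSet _⟶_ u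
reachableSet {n} {_⟶_ = _⟶_} _⟶?_ u =
  grow ⁅ u ⁆ (⊃-wellFounded ⁅ u ⁆) (x∈⁅x⁆ u)
    λ x∈⁅u⁆ → subst (Star _⟶_ u) (sym (x∈⁅y⁆⇒x≡y u x∈⁅u⁆)) ε
  where
  grow : (T : Subset n) → Acc _⊃_ T → u ∈ T →
         (∀ {x} → x ∈ T → Star _⟶_ u x) → ReachableSet _⟶_ u
  grow T (acc larger) u∈T path
    with any? (λ x → any? (λ y → (x ∈? T) ×-dec (x ⟶? y) ×-dec ¬? (y ∈? T)))
  ... | yes (x , y , x∈T , x⟶y , y∉T) =
    grow (⁅ y ⁆ ∪ T) (larger (q⊆p∪q ⁅ y ⁆ T , y , p⊆p∪q T (x∈⁅x⁆ y) , y∉T))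
         (q⊆p∪q ⁅ y ⁆ T u∈T) path′
    where
    path′ : ∀ {z} → z ∈ ⁅ y ⁆ ∪ T → Star _⟶_ u z
    path′ z∈ with x∈p∪q⁻ ⁅ y ⁆ T z∈
    ... | inj₁ z∈⁅y⁆ = subst (Star _⟶_ u) (sym (x∈⁅y⁆⇒x≡y y z∈⁅y⁆)) (path x∈T ◅◅ (x⟶y ◅ ε))
    ... | inj₂ z∈T   = path z∈T
  ... | no ¬leaving = record { nodes = T ; source∈ = u∈T ; path = path ; closed = closed }
    where
    closed : ∀ {x y} → x ∈ T → x ⟶ y → y ∈ T
    closed {x} {y} x∈T x⟶y =
      decidable-stable (y ∈? T) λ y∉T → ¬leaving (x , y , x∈T , x⟶y , y∉T)

module _ {n : ℕ} (G : SSG n) where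
  open SSG G

  HasOutArcs : NodeType → Set
  HasOutArcs t = (t ≡ maxN) ⊎ (t ≡ minN) ⊎ (t ≡ avgN)

  hasOutArcs? : ∀ t → Dec (HasOutArcs t)
  hasOutArcs? maxN  = yes (inj₁ refl)
  hasOutArcs? minN  = yes (inj₂ (inj₁ refl))
  hasOutArcs? avgN  = yes (inj₂ (inj₂ refl))
  hasOutArcs? term0 = no λ { (inj₁ ()) ; (inj₂ (inj₁ ())) ; (inj₂ (inj₂ ())) }
  hasOutArcs? term1 = no λ { (inj₁ ()) ; (inj₂ (inj₁ ())) ; (inj₂ (inj₂ ())) }

  arcIn? : ∀ S → Decidable (ArcIn G S)
  arcIn? S u v = (u ∈? S) ×-dec (v ∈? S) ×-dec hasOutArcs? (type u)
                 ×-dec ((out₁ u ≟ v) ⊎-dec (out₂ u ≟ v))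

  pathIn-target∈ : ∀ {S u v} → u ∈ S → PathIn G S u v → v ∈ S
  pathIn-target∈ u∈S ε                     = u∈S
  pathIn-target∈ _   ((_ , w∈S , _) ◅ path) = pathIn-target∈ w∈S path

  arcClosed⇒Closed : ∀ {S T} → Closed G S → T ⊆ S →
                     (∀ {x y} → x ∈ T → ArcIn G S x y → y ∈ T) → Closed G T
  arcClosed⇒Closed {S} {T} closedS T⊆S arcClosed v v∈T
    with closedS v (T⊆S v∈T)
  ... | max , min , avg , ¬term0 , ¬term1 =
      (λ t → Sum.map (follow₁ (inj₁ t)) (follow₂ (inj₁ t)) (max t))
    , (λ t → Sum.map (follow₁ (inj₂ (inj₁ t))) (follow₂ (inj₂ (inj₁ t))) (min t))
    , (λ t → Product.map (follow₁ (inj₂ (inj₂ t))) (follow₂ (inj₂ (inj₂ t))) (avg t))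
    , ¬term0 , ¬term1
    where
    follow₁ : HasOutArcs (type v) → out₁ v ∈ S → out₁ v ∈ T
    follow₁ hasOut w∈S = arcClosed v∈T (T⊆S v∈T , w∈S , hasOut , inj₁ refl)
    follow₂ : HasOutArcs (type v) → out₂ v ∈ S → out₂ v ∈ T
    follow₂ hasOut w∈S = arcClosed v∈T (T⊆S v∈T , w∈S , hasOut , inj₂ refl)

  reachableIn : ∀ S u → ReachableSet (ArcIn G S) u
  reachableIn S = reachableSet (arcIn? S)

  badSubgraph-⊆ : ∀ S → Acc _⊂_ S → Nonempty S → Closed G S →
                  ∃[ S′ ] (S′ ⊆ S × BadSubgraph G S′)
  badSubgraph-⊆ S (acc smaller) nonempty closedS
    with any? (λ u → any? (λ z →
           (u ∈? S) ×-dec (z ∈? S) ×-dec ¬? (z ∈? ReachableSet.nodes (reachableIn S u))))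
  ... | no ¬unreached = S , ⊆-refl , nonempty , closedS , stronglyConnected
    where
    stronglyConnected : StronglyConnected G S
    stronglyConnected u z u∈S z∈S =
      ReachableSet.path (reachableIn S u)
        (decidable-stable (z ∈? _) λ z∉R → ¬unreached (u , z , u∈S , z∈S , z∉R))
  ... | yes (u , z , u∈S , z∈S , z∉R) =
    let S′ , S′⊆R , bad = badSubgraph-⊆ R (smaller (R⊆S , z , z∈S , z∉R)) (u , source∈) closedR
    in  S′ , ⊆-trans S′⊆R R⊆S , bad
    where
    open ReachableSet (reachableIn S u) renaming (nodes to R)
    R⊆S : R ⊆ S
    R⊆S x∈R = pathIn-target∈ u∈S (path x∈R)
    closedR : Closed G R
    closedR = arcClosed⇒Closed closedS R⊆S closed

lemma1 : ∀ {n} (G : SSG n) (S : Subset n) → Nonempty S → Closed G S →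
    ∃[ S′ ] (S′ ⊆ S × BadSubgraph G S′)
lemma1 G S = badSubgraph-⊆ G S (⊂-wellFounded S)
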